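{- Let $H$ be a maximal plane graph and $f$ a face of $H$ whose boundary vertices are $x,y,z$. Let $k=q(H[f])$. If $(k)_{x,y,z}$ is nonempty, then every vertex of $\mathrm{qcc}_H(H[f])$ lies in $(k)$, i.e., is at distance exactly $k$ from $\{x,y,z\}$.
   Context: $H$ is a maximal plane graph (plane embedding of a maximal planar graph, every face bounded by a triangle); $d$ is shortest-path distance in $H$. $\mathrm{qcc}_H(S)=\{u\in V(H): \forall v\in V(H)\ \exists s\in S \text{ with } d(u,s)\geq d(v,s)\}$, and $Q:=\mathrm{qcc}_H(\{x,y,z\})$. The quasi-eccentricity is $q(H[f])=d(\{x,y,z\},Q)=\min\{d(a,b):a\in\{x,y,z\},b\in Q\}$. For an integer $k$ and disjoint $A,B\subseteq\{x,y,z\}$, $(k)_A^B$ denotes the set of $u\in Q$ with $\min_{t\in\{x,y,z\}}d(u,t)=k$, $d(u,t)=k$ for all $t\in A$ and $d(u,t)=k+1$ for all $t\in B$; $(k)$ is this set with $A=B=\emptyset$, and subscripts/superscripts are written as lists (e.g. $(k)_{x,y,z}$ means $d(u,x)=d(u,y)=d(u,z)=k$). -}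

module Defs where

open import Data.Nat using (ℕ; zero; suc; _+_; _*_; _≤_; _<_; _≤?_)
open import Data.Fin using (Fin; toℕ)
open import Data.Fin.Properties using (all?)
open import Data.List using (List; length; filter)
open import Data.List using () renaming (allFin to allFinL)
open import Data.Product using (Σ; ∃; _×_; _,_)
open import Data.Sum using (_⊎_)
open import Relation.Nullary using (¬_; Dec)
open import Relation.Binary.PropositionalEquality using (_≡_; _≢_)

iter : {A : Set} → (A → A) → ℕ → A → A
iter f zero    a = a
iter f (suc i) a = f (iter f i a)

-- Number of orbits of an endofunction p on Fin m (p is a permutation in our use):
-- we count the darts d that are the least element (w.r.t. toℕ) of their orbit
-- {p^i d : i < m}.
IsOrbitRep : {m : ℕ} → (Fin m → Fin m) → Fin m → Set
IsOrbitRep {m} p d = (i : Fin m) → toℕ d ≤ toℕ (iter p (toℕ i) d)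

isOrbitRep? : {m : ℕ} → (p : Fin m → Fin m) → (d : Fin m) → Dec (IsOrbitRep p d)
isOrbitRep? p d = all? (λ i → toℕ d ≤? toℕ (iter p (toℕ i) d))

numOrbits : {m : ℕ} → (Fin m → Fin m) → ℕ
numOrbits {m} p = length (filter (isOrbitRep? p) (allFinL m))

data Walk {V : Set} (Adj : V → V → Set) : V → V → ℕ → Set where
  here : ∀ {u} → Walk Adj u u 0
  step : ∀ {u w t k} → Adj u w → Walk Adj w t k → Walk Adj u t (suc k)

-- Combinatorial map / rotation-system description of a maximal plane graph
-- (plane triangulation).  Vertices are Fin n, darts (half-edges) are Fin m.
--   tail d : the vertex at which dart d starts
--   α      : fixed-point-free involution pairing the two darts of an edge
--   σ      : rotation (cyclic order of darts around each vertex); its orbits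
--            are exactly the sets of darts at a vertex
--   φ = σ ∘ α : face permutation; its orbits are the faces, the boundary of
--            the face of d traverses tail d, tail (φ d), tail (φ (φ d)), ...
record MaximalPlaneGraph : Set where
  field
    n m   : ℕ
    tail  : Fin m → Fin n
    α     : Fin m → Fin m
    σ     : Fin m → Fin m
    σ⁻¹   : Fin m → Fin m
    α-invol   : ∀ d → α (α d) ≡ d
    α-noFix   : ∀ d → α d ≢ d
    σ-inv₁    : ∀ d → σ (σ⁻¹ d) ≡ d
    σ-inv₂    : ∀ d → σ⁻¹ (σ d) ≡ d
    tail-σ    : ∀ d → tail (σ d) ≡ tail d
    tail-orbit : ∀ d d' → tail d ≡ tail d' → ∃ λ i → iter σ i d ≡ d'
    tail-surj : ∀ u → ∃ λ d → tail d ≡ u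
  head : Fin m → Fin n
  head d = tail (α d)
  Adj : Fin n → Fin n → Set
  Adj u w = ∃ λ d → tail d ≡ u × head d ≡ w
  φ : Fin m → Fin m
  φ d = σ (α d)
  field
    noLoop    : ∀ d → tail d ≢ head d
    noMulti   : ∀ d d' → tail d ≡ tail d' → head d ≡ head d' → d ≡ d'
    connected : ∀ u w → ∃ λ k → Walk Adj u w k
    -- plane: Euler's formula V - E + F = 2 with E = m/2, i.e. 2V + 2F = m + 4
    euler     : 2 * n + 2 * numOrbits φ ≡ m + 4
    face-tri  : ∀ d → φ (φ (φ d)) ≡ d
    face-nondeg : ∀ d → φ d ≢ d

module _ (H : MaximalPlaneGraph) where
  open MaximalPlaneGraph H

  V : Set
  V = Fin n

  Dist : V → V → ℕ → Set
  Dist u w k = Walk Adj u w k × (∀ j → j < k → ¬ Walk Adj u w j)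

  In3 : V → V → V → V → Set
  In3 x y z t = t ≡ x ⊎ t ≡ y ⊎ t ≡ z

  InQcc : V → V → V → V → Set
  InQcc x y z u = ∀ v → ∃ λ s → In3 x y z s ×
                    (∀ a b → Dist u s a → Dist v s b → b ≤ a)

  DistSet : V → V → V → V → ℕ → Set
  DistSet x y z u k = (∃ λ t → In3 x y z t × Dist u t k) ×
                      (∀ t j → In3 x y z t → Dist u t j → k ≤ j)

  QuasiEcc : V → V → V → ℕ → Set
  QuasiEcc x y z k = (∃ λ a → ∃ λ b → In3 x y z a × InQcc x y z b × Dist a b k) ×
                     (∀ a b j → In3 x y z a → InQcc x y z b → Dist a b j → k ≤ j)

{-# OPTIONS --safe #-}
-- Pick u₀ ∈ Q at distance k from each of x, y, z. For u ∈ Q, applying the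
-- defining property of u₀ ∈ Q to v = u yields s ∈ {x,y,z} with
-- d(u,s) ≤ d(u₀,s) = k, whereas the minimality of k = q(H[f]) gives
-- d(u,t) ≥ k for every t ∈ {x,y,z}. Hence d(u,{x,y,z}) = k.
module Submission where

open import Defs
open import Data.Nat using (ℕ; zero; suc; _+_; _≤_; _<_)
open import Data.Nat.Properties using (anyUpTo?; ≤-antisym; +-comm)
open import Data.Nat.Induction using (<-wellFounded)
open import Data.Fin using (Fin; _≟_)
open import Data.Fin.Properties using (any?)
open import Data.Product using (∃; _×_; _,_)
open import Data.Sum using (inj₁; inj₂)
open import Induction.WellFounded using (Acc; acc)
open import Relation.Binary.Definitions using (Symmetric)
open import Relation.Nullary using (¬_; Dec; yes; no)
open import Relation.Nullary.Decidable using (_×-dec_)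
open import Relation.Unary using (Pred; Decidable)
open import Relation.Binary.PropositionalEquality using (_≡_; refl; sym; subst)

least-witness : ∀ {p} {P : Pred ℕ p} → Decidable P →
                ∀ K → P K → ∃ λ j → P j × (∀ l → l < j → ¬ P l)
least-witness {P = P} P? K = go (<-wellFounded K)
  where
  go : ∀ {i} → Acc _<_ i → P i → ∃ λ j → P j × (∀ l → l < j → ¬ P l)
  go {i} (acc rs) pi with anyUpTo? P? i
  ... | no none            = i , pi , λ l l<i pl → none (l , l<i , pl)
  ... | yes (l , l<i , pl) = go (rs l<i) pl

module _ {V : Set} {Adj : V → V → Set} where

  walk-++ : ∀ {u v w k j} → Walk Adj u v k → Walk Adj v w j → Walk Adj u w (k + j)
  walk-++ here       q = q
  walk-++ (step a p) q = step a (walk-++ p q)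

  walk-reverse : Symmetric Adj → ∀ {u w k} → Walk Adj u w k → Walk Adj w u k
  walk-reverse adj-sym here = here
  walk-reverse adj-sym {k = suc k} (step a p) =
    subst (Walk Adj _ _) (+-comm k 1)
          (walk-++ (walk-reverse adj-sym p) (step (adj-sym a) here))

module _ {n : ℕ} {Adj : Fin n → Fin n → Set} (adj? : ∀ u w → Dec (Adj u w)) where

  walk? : ∀ k u w → Dec (Walk Adj u w k)
  walk? zero u w with u ≟ w
  ... | yes refl = yes here
  ... | no u≢w   = no λ { here → u≢w refl }
  walk? (suc k) u w with any? (λ v → adj? u v ×-dec walk? k v w)
  ... | yes (v , a , p) = yes (step a p)
  ... | no none         = no λ { (step a p) → none (_ , a , p) }

module _ (H : MaximalPlaneGraph) where
  open MaximalPlaneGraph H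

  Adj-sym : Symmetric Adj
  Adj-sym {u} (d , tail-d , head-d) =
    α d , head-d , subst (λ e → tail e ≡ u) (sym (α-invol d)) tail-d

  adj? : ∀ u w → Dec (Adj u w)
  adj? u w = any? (λ d → (tail d ≟ u) ×-dec (head d ≟ w))

  dist-sym : ∀ {u w k} → Dist H u w k → Dist H w u k
  dist-sym (p , shortest) =
    walk-reverse Adj-sym p , λ j j<k q → shortest j j<k (walk-reverse Adj-sym q)

  dist-exists : ∀ u w → ∃ λ k → Dist H u w k
  dist-exists u w with connected u w
  ... | K , p = least-witness (λ j → walk? adj? j u w) K p

  In3-all : ∀ {x y z} (P : V H → Set) → P x → P y → P z →
            ∀ {t} → In3 H x y z t → P t
  In3-all P px py pz (inj₁ refl)        = px
  In3-all P px py pz (inj₂ (inj₁ refl)) = py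
  In3-all P px py pz (inj₂ (inj₂ refl)) = pz

  QuasiEcc-≤-Dist : ∀ {x y z k u t j} → QuasiEcc H x y z k → InQcc H x y z u →
                    In3 H x y z t → Dist H u t j → k ≤ j
  QuasiEcc-≤-Dist (_ , minimal) u∈Q t∈xyz u-t = minimal _ _ _ t∈xyz u∈Q (dist-sym u-t)

lemma11 : (H : MaximalPlaneGraph) →
    let open MaximalPlaneGraph H in
    (f : Fin m) (x y z : Fin n) →
    x ≡ tail f → y ≡ tail (φ f) → z ≡ tail (φ (φ f)) →
    (k : ℕ) → QuasiEcc H x y z k →
    (∃ λ u → InQcc H x y z u × Dist H u x k × Dist H u y k × Dist H u z k) →
    ∀ u → InQcc H x y z u → DistSet H x y z u k
lemma11 H f x y z _ _ _ k q (u₀ , u₀∈Q , u₀-x , u₀-y , u₀-z) u u∈Q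
  with u₀∈Q u
... | s , s∈xyz , u₀-farther with dist-exists H u s
... | j , u-s =
  (s , s∈xyz , subst (Dist H u s) j≡k u-s) , λ _ _ t∈xyz → QuasiEcc-≤-Dist H q u∈Q t∈xyz
  where
  u₀-s : Dist H u₀ s k
  u₀-s = In3-all H (λ t → Dist H u₀ t k) u₀-x u₀-y u₀-z s∈xyz

  j≡k : j ≡ k
  j≡k = ≤-antisym (u₀-farther k j u₀-s u-s) (QuasiEcc-≤-Dist H q u∈Q s∈xyz u-s)
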